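{- Let $G$ be a finite simple graph which has at least two distinct maximum independent sets, and let $Q$ be the set of all maximum independent sets of $G$. Then \[ \alpha(G) \le \mu(G) + \min\{\, |A \cap B| - \mu(G[N_G[A \cap B]]) : A, B \in Q \,\}. \]
   Context: $\alpha(G)$ is the independence number and $\mu(H)$ the matching number of a graph $H$ ($0$ if $H$ has no edges). For $S \subseteq V(G)$, $N_G[S] = S \cup \bigcup_{v \in S} N_G(v)$ and $G[S]$ is the induced subgraph on $S$. -}

module Defs where

open import Data.Nat using (ℕ; _≤_)
open import Data.Fin using (Fin)
open import Data.Fin.Subset using (Subset; _∈_; _∩_; ∣_∣)
open import Data.Product using (_×_; _,_; Σ; ∃; ∃-syntax)
open import Data.Sum using (_⊎_)
open import Data.List using (List; []; _∷_; length; concatMap)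
open import Data.List.Relation.Unary.All using (All)
open import Data.List.Relation.Unary.Unique.Propositional using (Unique)
open import Data.Unit using (⊤)
open import Relation.Nullary using (¬_)
open import Relation.Binary.PropositionalEquality using (_≡_)

record Graph (n : ℕ) : Set₁ where
  field
    Adj    : Fin n → Fin n → Set
    sym    : ∀ {u v} → Adj u v → Adj v u
    irrefl : ∀ {v} → ¬ Adj v v
open Graph public

IsIndependent : ∀ {n} → Graph n → Subset n → Set
IsIndependent G S = ∀ u v → u ∈ S → v ∈ S → ¬ Adj G u v

IsMaximumIndependent : ∀ {n} → Graph n → Subset n → Set
IsMaximumIndependent G S =
  IsIndependent G S × (∀ T → IsIndependent G T → ∣ T ∣ ≤ ∣ S ∣)

IsIndependenceNumber : ∀ {n} → Graph n → ℕ → Set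
IsIndependenceNumber {n} G a =
  Σ (Subset n) λ S → IsMaximumIndependent G S × ∣ S ∣ ≡ a

ClosedNbhd : ∀ {n} → Graph n → Subset n → Fin n → Set
ClosedNbhd G S v = v ∈ S ⊎ (∃[ u ] (u ∈ S × Adj G u v))

endpoints : ∀ {n} → List (Fin n × Fin n) → List (Fin n)
endpoints = concatMap (λ { (u , v) → u ∷ v ∷ [] })

-- A matching of the induced subgraph G[P] (P a vertex predicate):
-- a list of edges of G with both endpoints in P, no vertex covered twice.
IsMatchingIn : ∀ {n} → Graph n → (Fin n → Set) → List (Fin n × Fin n) → Set
IsMatchingIn G P M =
  All (λ { (u , v) → Adj G u v × P u × P v }) M × Unique (endpoints M)

IsMatchingNumberIn : ∀ {n} → Graph n → (Fin n → Set) → ℕ → Set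
IsMatchingNumberIn {n} G P m =
  Σ (List (Fin n × Fin n)) (λ M → IsMatchingIn G P M × length M ≡ m)
  × (∀ M → IsMatchingIn G P M → length M ≤ m)

Everything : ∀ {n} → Fin n → Set
Everything _ = ⊤

module Submission where

-- For Z ⊆ A ∖ B the set (B ∖ N(Z)) ∪ Z is independent,
-- so |Z| ≤ |B ∩ N(Z)| = |N(Z) ∩ (B ∖ A)|: Hall's condition holds and G[A △ B] has a matching of
-- size |A ∖ B|. No vertex of A △ B lies in N[A ∩ B], so adding a maximum matching of G[N[A ∩ B]]
-- gives a matching of G, whence μ ≥ |A ∖ B| + ν = α − |A ∩ B| + ν.

open import Defs hiding (sym)

module MatchingBound where
  open import Data.Empty using (⊥-elim)
  open import Data.Fin using (Fin; zero; suc)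
  open import Data.Fin.Properties using (any?; ∀-cons; _≟_)
  open import Data.Fin.Subset
  open import Data.Fin.Subset.Properties
  open import Data.List using (List; []; _∷_; length; _++_)
  open import Data.List.Properties using (length-++; concatMap-++)
  open import Data.List.Relation.Unary.All as All using (All; []; _∷_)
  open import Data.List.Relation.Unary.All.Properties using (++⁺)
  open import Data.List.Membership.Propositional using () renaming (_∈_ to _∈ₗ_)
  open import Data.List.Relation.Unary.AllPairs using ([]; _∷_)
  open import Data.List.Relation.Unary.Unique.Propositional using (Unique)
  import Data.List.Relation.Unary.Unique.Propositional.Properties as Unique
  open import Data.Nat using (ℕ; zero; suc; _+_; _≤_; _<_; z≤n; _≤?_; _<?_)
  open import Data.Nat.Properties hiding (_≟_)
  open import Data.Product using (_×_; _,_; Σ; ∃; ∃-syntax; proj₁; proj₂)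
  open import Data.Sum using (_⊎_; inj₁; inj₂)
  open import Data.Unit using (tt)
  open import Data.Vec using ([]; _∷_; tabulate; here; there)
  open import Data.Vec.Properties using (lookup∘tabulate; lookup⇒[]=; []=⇒lookup)
  open import Function using (_∘_)
  open import Relation.Binary.PropositionalEquality using (_≡_; refl; module ≡-Reasoning; sym; trans; cong; cong₂; subst)
  open import Relation.Nullary using (¬_; Dec; yes; no; does; _×-dec_)
  open import Relation.Nullary.Decidable using (dec-true; decidable-stable; ¬¬-excluded-middle)
  open import Relation.Nullary.Negation using (¬¬-map)
  open import Relation.Unary using (Decidable; _≬_) renaming (_∪_ to _∪ₚ_; _⊆_ to _⊆ₚ_)

  ¬¬-∀-Fin : ∀ {n} {P : Fin n → Set} → (∀ i → ¬ ¬ P i) → ¬ ¬ (∀ i → P i)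
  ¬¬-∀-Fin {zero}  _   ¬∀P = ¬∀P λ ()
  ¬¬-∀-Fin {suc n} ¬¬P ¬∀P = ¬¬P zero λ P₀ → ¬¬-∀-Fin (¬¬P ∘ suc) λ P∘suc → ¬∀P (∀-cons P₀ P∘suc)

  ¬¬-decidable : ∀ {n} (R : Fin n → Fin n → Set) → ¬ ¬ (∀ u v → Dec (R u v))
  ¬¬-decidable R = ¬¬-∀-Fin λ u → ¬¬-∀-Fin λ v → ¬¬-excluded-middle

  fromDec : ∀ {n} {P : Fin n → Set} → Decidable P → Subset n
  fromDec P? = tabulate (does ∘ P?)

  ∈fromDec⁺ : ∀ {n} {P : Fin n → Set} (P? : Decidable P) {x} → P x → x ∈ fromDec P?
  ∈fromDec⁺ P? {x} Px = lookup⇒[]= x _ (trans (lookup∘tabulate _ x) (dec-true (P? x) Px))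

  ∈fromDec⁻ : ∀ {n} {P : Fin n → Set} (P? : Decidable P) {x} → x ∈ fromDec P? → P x
  ∈fromDec⁻ P? {x} x∈ with P? x | trans (sym (lookup∘tabulate (does ∘ P?) x)) ([]=⇒lookup x∈)
  ... | yes Px | _  = Px
  ... | no  _  | ()

  ∣p∪q∣+∣p∩q∣≡∣p∣+∣q∣ : ∀ {n} (p q : Subset n) → ∣ p ∪ q ∣ + ∣ p ∩ q ∣ ≡ ∣ p ∣ + ∣ q ∣
  ∣p∪q∣+∣p∩q∣≡∣p∣+∣q∣ []            []            = refl
  ∣p∪q∣+∣p∩q∣≡∣p∣+∣q∣ (inside  ∷ p) (inside  ∷ q) =
    cong suc (trans (+-suc ∣ p ∪ q ∣ ∣ p ∩ q ∣)
      (trans (cong suc (∣p∪q∣+∣p∩q∣≡∣p∣+∣q∣ p q)) (sym (+-suc ∣ p ∣ ∣ q ∣))))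
  ∣p∪q∣+∣p∩q∣≡∣p∣+∣q∣ (inside  ∷ p) (outside ∷ q) = cong suc (∣p∪q∣+∣p∩q∣≡∣p∣+∣q∣ p q)
  ∣p∪q∣+∣p∩q∣≡∣p∣+∣q∣ (outside ∷ p) (inside  ∷ q) =
    trans (cong suc (∣p∪q∣+∣p∩q∣≡∣p∣+∣q∣ p q)) (sym (+-suc ∣ p ∣ ∣ q ∣))
  ∣p∪q∣+∣p∩q∣≡∣p∣+∣q∣ (outside ∷ p) (outside ∷ q) = ∣p∪q∣+∣p∩q∣≡∣p∣+∣q∣ p q

  ∣p∪q∣≤∣p∣+∣q∣ : ∀ {n} (p q : Subset n) → ∣ p ∪ q ∣ ≤ ∣ p ∣ + ∣ q ∣
  ∣p∪q∣≤∣p∣+∣q∣ p q = subst (∣ p ∪ q ∣ ≤_) (∣p∪q∣+∣p∩q∣≡∣p∣+∣q∣ p q) (m≤m+n _ _)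

  ∣p∪q∣≡∣p∣+∣q∣ : ∀ {n} {p q : Subset n} → Empty (p ∩ q) → ∣ p ∪ q ∣ ≡ ∣ p ∣ + ∣ q ∣
  ∣p∪q∣≡∣p∣+∣q∣ {n} {p} {q} p∩q-empty = begin
    ∣ p ∪ q ∣              ≡⟨ +-identityʳ _ ⟨
    ∣ p ∪ q ∣ + 0          ≡⟨ cong (∣ p ∪ q ∣ +_) (∣⊥∣≡0 n) ⟨
    ∣ p ∪ q ∣ + ∣ ⊥ {n} ∣  ≡⟨ cong (λ r → ∣ p ∪ q ∣ + ∣ r ∣) (Empty-unique p∩q-empty) ⟨
    ∣ p ∪ q ∣ + ∣ p ∩ q ∣  ≡⟨ ∣p∪q∣+∣p∩q∣≡∣p∣+∣q∣ p q ⟩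
    ∣ p ∣ + ∣ q ∣          ∎
    where open ≡-Reasoning

  ∣p∣≡∣p∩q∣+∣p─q∣ : ∀ {n} (p q : Subset n) → ∣ p ∣ ≡ ∣ p ∩ q ∣ + ∣ p ─ q ∣
  ∣p∣≡∣p∩q∣+∣p─q∣ []            []            = refl
  ∣p∣≡∣p∩q∣+∣p─q∣ (inside  ∷ p) (inside  ∷ q) = cong suc (∣p∣≡∣p∩q∣+∣p─q∣ p q)
  ∣p∣≡∣p∩q∣+∣p─q∣ (inside  ∷ p) (outside ∷ q) =
    trans (cong suc (∣p∣≡∣p∩q∣+∣p─q∣ p q)) (sym (+-suc ∣ p ∩ q ∣ ∣ p ─ q ∣))
  ∣p∣≡∣p∩q∣+∣p─q∣ (outside ∷ p) (inside  ∷ q) = ∣p∣≡∣p∩q∣+∣p─q∣ p q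
  ∣p∣≡∣p∩q∣+∣p─q∣ (outside ∷ p) (outside ∷ q) = ∣p∣≡∣p∩q∣+∣p─q∣ p q

  q⊆p⇒∣p∣≡∣q∣+∣p─q∣ : ∀ {n} {p q : Subset n} → q ⊆ p → ∣ p ∣ ≡ ∣ q ∣ + ∣ p ─ q ∣
  q⊆p⇒∣p∣≡∣q∣+∣p─q∣ {p = p} {q} q⊆p =
    trans (∣p∣≡∣p∩q∣+∣p─q∣ p q) (cong (λ r → ∣ r ∣ + ∣ p ─ q ∣) p∩q≡q)
    where
    p∩q≡q : p ∩ q ≡ q
    p∩q≡q = ⊆-antisym (λ x∈p∩q → proj₂ (x∈p∩q⁻ p q x∈p∩q)) (λ x∈q → x∈p∩q⁺ (q⊆p x∈q , x∈q))

  x∈p─q⇒x∉q : ∀ {n} {p q : Subset n} {x} → x ∈ p ─ q → x ∉ q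
  x∈p─q⇒x∉q {p = _ ∷ _} {_ ∷ _} (there x∈p─q) (there x∈q) = x∈p─q⇒x∉q x∈p─q x∈q

  0<∣p∣⇒Nonempty : ∀ {n} (p : Subset n) → 0 < ∣ p ∣ → Nonempty p
  0<∣p∣⇒Nonempty (inside  ∷ p) _   = zero , here
  0<∣p∣⇒Nonempty (outside ∷ p) 0<∣p∣ with 0<∣p∣⇒Nonempty p 0<∣p∣
  ... | x , x∈p = suc x , there x∈p

  HasMatchingOfSize : ∀ {n} → Graph n → (Fin n → Set) → ℕ → Set
  HasMatchingOfSize {n} G P m =
    Σ (List (Fin n × Fin n)) (λ M → IsMatchingIn G P M × length M ≡ m)

  module _ {n} (G : Graph n) where

    endpoints-in : ∀ {P M} → IsMatchingIn G P M → All P (endpoints M)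
    endpoints-in {M = []}    _ = []
    endpoints-in {M = _ ∷ _} ((_ , Pu , Pv) ∷ edges , _ ∷ _ ∷ unique) =
      Pu ∷ Pv ∷ endpoints-in (edges , unique)

    hasMatching-mono : ∀ {P Q m} → P ⊆ₚ Q → HasMatchingOfSize G P m → HasMatchingOfSize G Q m
    hasMatching-mono P⊆Q (M , (edges , unique) , ∣M∣≡m) =
      M , (All.map (λ { (uv , Pu , Pv) → uv , P⊆Q Pu , P⊆Q Pv }) edges , unique) , ∣M∣≡m

    hasMatching-++ : ∀ {P Q a b} → ¬ (P ≬ Q) →
      HasMatchingOfSize G P a → HasMatchingOfSize G Q b → HasMatchingOfSize G (P ∪ₚ Q) (a + b)
    hasMatching-++ P∩Q=∅ (M₁ , m₁@(edges₁ , unique₁) , ∣M₁∣≡a)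
                         (M₂ , m₂@(edges₂ , unique₂) , ∣M₂∣≡b) =
      M₁ ++ M₂ ,
      ( ++⁺ (All.map (λ { (uv , Pu , Pv) → uv , inj₁ Pu , inj₁ Pv }) edges₁)
            (All.map (λ { (uv , Qu , Qv) → uv , inj₂ Qu , inj₂ Qv }) edges₂)
      , subst Unique (sym (concatMap-++ _ M₁ M₂)) (Unique.++⁺ unique₁ unique₂ endpoints-disjoint) ) ,
      trans (length-++ M₁) (cong₂ _+_ ∣M₁∣≡a ∣M₂∣≡b)
      where
      endpoints-disjoint : ∀ {v} → ¬ (v ∈ₗ endpoints M₁ × v ∈ₗ endpoints M₂)
      endpoints-disjoint (v∈M₁ , v∈M₂) =
        P∩Q=∅ (_ , All.lookup (endpoints-in m₁) v∈M₁ , All.lookup (endpoints-in m₂) v∈M₂)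

    hasMatching⇒≤matchingNumber : ∀ {P m μ} → IsMatchingNumberIn G P μ → HasMatchingOfSize G P m →
      m ≤ μ
    hasMatching⇒≤matchingNumber (_ , μ-max) (M , M-matching , refl) = μ-max M M-matching

    edge-hasMatching : ∀ {u v} → Adj G u v → HasMatchingOfSize G ((_≡ u) ∪ₚ (_≡ v)) 1
    edge-hasMatching {u} {v} uv =
      (u , v) ∷ [] , ((uv , inj₁ refl , inj₂ refl) ∷ [] , (u≢v ∷ []) ∷ [] ∷ []) , refl
      where
      u≢v : ¬ u ≡ v
      u≢v refl = irrefl G uv

  module Hall {n} (G : Graph n) (adj? : ∀ u v → Dec (Adj G u v)) where

    adjacentFrom? : ∀ Z → Decidable (λ y → ∃[ x ] (x ∈ Z × Adj G x y))
    adjacentFrom? Z y = any? λ x → x ∈? Z ×-dec adj? x y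

    N : Subset n → Subset n
    N Z = fromDec (adjacentFrom? Z)

    N⁺ : ∀ {Z x y} → x ∈ Z → Adj G x y → y ∈ N Z
    N⁺ {Z} x∈Z xy = ∈fromDec⁺ (adjacentFrom? Z) (_ , x∈Z , xy)

    N⁻ : ∀ {Z y} → y ∈ N Z → ∃[ x ] (x ∈ Z × Adj G x y)
    N⁻ {Z} = ∈fromDec⁻ (adjacentFrom? Z)

    N-mono : ∀ {W Z} → W ⊆ Z → N W ⊆ N Z
    N-mono W⊆Z y∈NW with N⁻ y∈NW
    ... | _ , x∈W , xy = N⁺ (W⊆Z x∈W) xy

    HallCondition : Subset n → Subset n → Set
    HallCondition X Y = ∀ Z → Z ⊆ X → ∣ Z ∣ ≤ ∣ N Z ∩ Y ∣

    IsCritical : Subset n → Subset n → Subset n → Set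
    IsCritical X Y Z = Z ⊆ X × 0 < ∣ Z ∣ × ∣ Z ∣ < ∣ X ∣ × ∣ N Z ∩ Y ∣ ≤ ∣ Z ∣

    critical? : ∀ X Y → Dec (∃ (IsCritical X Y))
    critical? X Y = anySubset? λ Z →
      Z ⊆? X ×-dec 0 <? ∣ Z ∣ ×-dec ∣ Z ∣ <? ∣ X ∣ ×-dec ∣ N Z ∩ Y ∣ ≤? ∣ Z ∣

    hallCondition-restrict : ∀ {X Y Z} → HallCondition X Y → Z ⊆ X → HallCondition Z (N Z ∩ Y)
    hallCondition-restrict {Y = Y} hall Z⊆X W W⊆Z =
      ≤-trans (hall W (⊆-trans W⊆Z Z⊆X)) (p⊆q⇒∣p∣≤∣q∣ NW∩Y⊆NW∩NZ∩Y)
      where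
      NW∩Y⊆NW∩NZ∩Y : N W ∩ Y ⊆ N W ∩ (N _ ∩ Y)
      NW∩Y⊆NW∩NZ∩Y v∈ with x∈p∩q⁻ (N W) Y v∈
      ... | v∈NW , v∈Y = x∈p∩q⁺ (v∈NW , x∈p∩q⁺ (N-mono W⊆Z v∈NW , v∈Y))

    hallCondition-contract : ∀ {X Y Z} → HallCondition X Y → Z ⊆ X → ∣ N Z ∩ Y ∣ ≤ ∣ Z ∣ →
      HallCondition (X ─ Z) (Y ─ (N Z ∩ Y))
    hallCondition-contract {X} {Y} {Z} hall Z⊆X Z-tight W W⊆X─Z =
      +-cancelʳ-≤ _ _ _ (begin
        ∣ W ∣ + ∣ Z ∣                     ≡⟨ ∣p∪q∣≡∣p∣+∣q∣ W∩Z-empty ⟨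
        ∣ W ∪ Z ∣                         ≤⟨ hall (W ∪ Z) W∪Z⊆X ⟩
        ∣ N (W ∪ Z) ∩ Y ∣                 ≤⟨ p⊆q⇒∣p∣≤∣q∣ split ⟩
        ∣ (N W ∩ (Y ─ N′)) ∪ N′ ∣         ≤⟨ ∣p∪q∣≤∣p∣+∣q∣ (N W ∩ (Y ─ N′)) N′ ⟩
        ∣ N W ∩ (Y ─ N′) ∣ + ∣ N′ ∣       ≤⟨ +-monoʳ-≤ ∣ N W ∩ (Y ─ N′) ∣ Z-tight ⟩
        ∣ N W ∩ (Y ─ N′) ∣ + ∣ Z ∣        ∎)
      where
      open ≤-Reasoning
      N′ = N Z ∩ Y
      W∩Z-empty : Empty (W ∩ Z)
      W∩Z-empty (_ , v∈W∩Z) with x∈p∩q⁻ W Z v∈W∩Z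
      ... | v∈W , v∈Z = x∈p─q⇒x∉q (W⊆X─Z v∈W) v∈Z
      W∪Z⊆X : W ∪ Z ⊆ X
      W∪Z⊆X v∈W∪Z with x∈p∪q⁻ W Z v∈W∪Z
      ... | inj₁ v∈W = p─q⊆p X Z (W⊆X─Z v∈W)
      ... | inj₂ v∈Z = Z⊆X v∈Z
      split : N (W ∪ Z) ∩ Y ⊆ (N W ∩ (Y ─ N′)) ∪ N′
      split {v} v∈ with x∈p∩q⁻ (N (W ∪ Z)) Y v∈ | v ∈? N′
      ... | _ , _ | yes v∈N′ = x∈p∪q⁺ (inj₂ v∈N′)
      ... | v∈N , v∈Y | no v∉N′ with N⁻ v∈N
      ...   | x , x∈W∪Z , xv with x∈p∪q⁻ W Z x∈W∪Z
      ...     | inj₁ x∈W = x∈p∪q⁺ (inj₁ (x∈p∩q⁺ (N⁺ x∈W xv , x∈p∧x∉q⇒x∈p─q v∈Y v∉N′)))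
      ...     | inj₂ x∈Z = ⊥-elim (v∉N′ (x∈p∩q⁺ (N⁺ x∈Z xv , v∈Y)))

    hallCondition-delete : ∀ {X Y x} y → HallCondition X Y → ¬ ∃ (IsCritical X Y) → x ∈ X →
      HallCondition (X - x) (Y - y)
    hallCondition-delete {X} {Y} {x} y hall no-critical x∈X W W⊆X-x with ∣ W ∣ ≤? 0
    ... | yes ∣W∣≤0 = ≤-trans ∣W∣≤0 z≤n
    ... | no  ∣W∣≰0 = ≤-pred (begin-strict
        ∣ W ∣                                <⟨ ≰⇒> W-not-tight ⟩
        ∣ N W ∩ Y ∣                          ≤⟨ p⊆q⇒∣p∣≤∣q∣ split ⟩
        ∣ ⁅ y ⁆ ∪ (N W ∩ (Y - y)) ∣          ≤⟨ ∣p∪q∣≤∣p∣+∣q∣ ⁅ y ⁆ (N W ∩ (Y - y)) ⟩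
        ∣ ⁅ y ⁆ ∣ + ∣ N W ∩ (Y - y) ∣        ≡⟨ cong (_+ ∣ N W ∩ (Y - y) ∣) (∣⁅x⁆∣≡1 y) ⟩
        suc ∣ N W ∩ (Y - y) ∣                ∎)
      where
      open ≤-Reasoning
      W⊆X : W ⊆ X
      W⊆X = ⊆-trans W⊆X-x (p─q⊆p X ⁅ x ⁆)
      ∣W∣<∣X∣ : ∣ W ∣ < ∣ X ∣
      ∣W∣<∣X∣ = ≤-<-trans (p⊆q⇒∣p∣≤∣q∣ W⊆X-x) (x∈p⇒∣p-x∣<∣p∣ x∈X)
      W-not-tight : ¬ ∣ N W ∩ Y ∣ ≤ ∣ W ∣
      W-not-tight tight = no-critical (W , W⊆X , ≰⇒> ∣W∣≰0 , ∣W∣<∣X∣ , tight)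
      split : N W ∩ Y ⊆ ⁅ y ⁆ ∪ (N W ∩ (Y - y))
      split {v} v∈ with x∈p∩q⁻ (N W) Y v∈ | v ≟ y
      ... | _ , _       | yes refl = x∈p∪q⁺ (inj₁ (x∈⁅x⁆ y))
      ... | v∈NW , v∈Y | no v≢y   = x∈p∪q⁺ (inj₂ (x∈p∩q⁺ (v∈NW , x∈p∧x≢y⇒x∈p-y v∈Y v≢y)))

    HallBelow : ℕ → Set
    HallBelow k = ∀ X Y → ∣ X ∣ < k → ¬ ((_∈ X) ≬ (_∈ Y)) → HallCondition X Y →
      HasMatchingOfSize G ((_∈ X) ∪ₚ (_∈ Y)) ∣ X ∣

    hall-critical : ∀ {k X Y Z} → HallBelow k → ∣ X ∣ ≤ k → ¬ ((_∈ X) ≬ (_∈ Y)) →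
      HallCondition X Y → IsCritical X Y Z → HasMatchingOfSize G ((_∈ X) ∪ₚ (_∈ Y)) ∣ X ∣
    hall-critical {X = X} {Y} {Z} hall-below ∣X∣≤k X∩Y=∅ hallXY (Z⊆X , 0<∣Z∣ , ∣Z∣<∣X∣ , Z-tight) =
      subst (HasMatchingOfSize G _) (sym ∣X∣≡∣Z∣+∣X─Z∣)
        (hasMatching-mono G into-X∪Y (hasMatching-++ G parts-disjoint
          (hall-below Z N′ (<-≤-trans ∣Z∣<∣X∣ ∣X∣≤k) Z∩N′=∅ (hallCondition-restrict hallXY Z⊆X))
          (hall-below (X ─ Z) (Y ─ N′) (<-≤-trans ∣X─Z∣<∣X∣ ∣X∣≤k) X─Z∩Y─N′=∅
            (hallCondition-contract hallXY Z⊆X Z-tight))))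
      where
      N′ = N Z ∩ Y
      N′⊆Y : N′ ⊆ Y
      N′⊆Y = p∩q⊆q (N Z) Y
      ∣X∣≡∣Z∣+∣X─Z∣ : ∣ X ∣ ≡ ∣ Z ∣ + ∣ X ─ Z ∣
      ∣X∣≡∣Z∣+∣X─Z∣ = q⊆p⇒∣p∣≡∣q∣+∣p─q∣ Z⊆X
      ∣X─Z∣<∣X∣ : ∣ X ─ Z ∣ < ∣ X ∣
      ∣X─Z∣<∣X∣ = subst (∣ X ─ Z ∣ <_) (sym ∣X∣≡∣Z∣+∣X─Z∣) (+-monoˡ-≤ ∣ X ─ Z ∣ 0<∣Z∣)
      Z∩N′=∅ : ¬ ((_∈ Z) ≬ (_∈ N′))
      Z∩N′=∅ (v , v∈Z , v∈N′) = X∩Y=∅ (v , Z⊆X v∈Z , N′⊆Y v∈N′)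
      X─Z∩Y─N′=∅ : ¬ ((_∈ X ─ Z) ≬ (_∈ Y ─ N′))
      X─Z∩Y─N′=∅ (v , v∈X─Z , v∈Y─N′) = X∩Y=∅ (v , p─q⊆p X Z v∈X─Z , p─q⊆p Y N′ v∈Y─N′)
      parts-disjoint : ¬ (((_∈ Z) ∪ₚ (_∈ N′)) ≬ ((_∈ X ─ Z) ∪ₚ (_∈ Y ─ N′)))
      parts-disjoint (v , inj₁ v∈Z  , inj₁ v∈X─Z)  = x∈p─q⇒x∉q v∈X─Z v∈Z
      parts-disjoint (v , inj₁ v∈Z  , inj₂ v∈Y─N′) = X∩Y=∅ (v , Z⊆X v∈Z , p─q⊆p Y N′ v∈Y─N′)
      parts-disjoint (v , inj₂ v∈N′ , inj₁ v∈X─Z)  = X∩Y=∅ (v , p─q⊆p X Z v∈X─Z , N′⊆Y v∈N′)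
      parts-disjoint (v , inj₂ v∈N′ , inj₂ v∈Y─N′) = x∈p─q⇒x∉q v∈Y─N′ v∈N′
      into-X∪Y : ((_∈ Z) ∪ₚ (_∈ N′)) ∪ₚ ((_∈ X ─ Z) ∪ₚ (_∈ Y ─ N′)) ⊆ₚ (_∈ X) ∪ₚ (_∈ Y)
      into-X∪Y (inj₁ (inj₁ v∈Z))    = inj₁ (Z⊆X v∈Z)
      into-X∪Y (inj₁ (inj₂ v∈N′))   = inj₂ (N′⊆Y v∈N′)
      into-X∪Y (inj₂ (inj₁ v∈X─Z))  = inj₁ (p─q⊆p X Z v∈X─Z)
      into-X∪Y (inj₂ (inj₂ v∈Y─N′)) = inj₂ (p─q⊆p Y N′ v∈Y─N′)

    hall-surplus : ∀ {k X Y x} → HallBelow k → ∣ X ∣ ≤ k → ¬ ((_∈ X) ≬ (_∈ Y)) →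
      HallCondition X Y → ¬ ∃ (IsCritical X Y) → x ∈ X →
      HasMatchingOfSize G ((_∈ X) ∪ₚ (_∈ Y)) ∣ X ∣
    hall-surplus {X = X} {Y} {x} hall-below ∣X∣≤k X∩Y=∅ hallXY no-critical x∈X =
      subst (HasMatchingOfSize G _) (sym ∣X∣≡1+∣X-x∣)
        (hasMatching-mono G into-X∪Y (hasMatching-++ G parts-disjoint
          (edge-hasMatching G xy)
          (hall-below (X - x) (Y - y) (<-≤-trans (x∈p⇒∣p-x∣<∣p∣ x∈X) ∣X∣≤k) X-x∩Y-y=∅
            (hallCondition-delete y hallXY no-critical x∈X))))
      where
      ⁅x⁆⊆X : ⁅ x ⁆ ⊆ X
      ⁅x⁆⊆X v∈⁅x⁆ = subst (_∈ X) (sym (x∈⁅y⁆⇒x≡y x v∈⁅x⁆)) x∈X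
      ∣X∣≡1+∣X-x∣ : ∣ X ∣ ≡ 1 + ∣ X - x ∣
      ∣X∣≡1+∣X-x∣ = trans (q⊆p⇒∣p∣≡∣q∣+∣p─q∣ ⁅x⁆⊆X) (cong (_+ ∣ X - x ∣) (∣⁅x⁆∣≡1 x))
      partner : Nonempty (N ⁅ x ⁆ ∩ Y)
      partner = 0<∣p∣⇒Nonempty (N ⁅ x ⁆ ∩ Y)
        (subst (_≤ ∣ N ⁅ x ⁆ ∩ Y ∣) (∣⁅x⁆∣≡1 x) (hallXY ⁅ x ⁆ ⁅x⁆⊆X))
      y = proj₁ partner
      y∈N⁅x⁆ : y ∈ N ⁅ x ⁆
      y∈N⁅x⁆ = p∩q⊆p (N ⁅ x ⁆) Y (proj₂ partner)
      y∈Y : y ∈ Y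
      y∈Y = p∩q⊆q (N ⁅ x ⁆) Y (proj₂ partner)
      xy : Adj G x y
      xy with N⁻ y∈N⁅x⁆
      ... | x′ , x′∈⁅x⁆ , x′y = subst (λ u → Adj G u y) (x∈⁅y⁆⇒x≡y x x′∈⁅x⁆) x′y
      X-x∩Y-y=∅ : ¬ ((_∈ X - x) ≬ (_∈ Y - y))
      X-x∩Y-y=∅ (v , v∈X-x , v∈Y-y) = X∩Y=∅ (v , p─q⊆p X ⁅ x ⁆ v∈X-x , p─q⊆p Y ⁅ y ⁆ v∈Y-y)
      parts-disjoint : ¬ (((_≡ x) ∪ₚ (_≡ y)) ≬ ((_∈ X - x) ∪ₚ (_∈ Y - y)))
      parts-disjoint (_ , inj₁ refl , inj₁ x∈X-x) = x∈p─q⇒x∉q x∈X-x (x∈⁅x⁆ x)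
      parts-disjoint (_ , inj₁ refl , inj₂ x∈Y-y) = X∩Y=∅ (x , x∈X , p─q⊆p Y ⁅ y ⁆ x∈Y-y)
      parts-disjoint (_ , inj₂ refl , inj₁ y∈X-x) = X∩Y=∅ (y , p─q⊆p X ⁅ x ⁆ y∈X-x , y∈Y)
      parts-disjoint (_ , inj₂ refl , inj₂ y∈Y-y) = x∈p─q⇒x∉q y∈Y-y (x∈⁅x⁆ y)
      into-X∪Y : ((_≡ x) ∪ₚ (_≡ y)) ∪ₚ ((_∈ X - x) ∪ₚ (_∈ Y - y)) ⊆ₚ (_∈ X) ∪ₚ (_∈ Y)
      into-X∪Y (inj₁ (inj₁ refl))     = inj₁ x∈X
      into-X∪Y (inj₁ (inj₂ refl))     = inj₂ y∈Y
      into-X∪Y (inj₂ (inj₁ v∈X-x))    = inj₁ (p─q⊆p X ⁅ x ⁆ v∈X-x)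
      into-X∪Y (inj₂ (inj₂ v∈Y-y))    = inj₂ (p─q⊆p Y ⁅ y ⁆ v∈Y-y)

    -- Halmos–Vaughan: split X along a critical set if there is one; otherwise every proper
    -- nonempty subset has surplus, so any single edge at x can be used and removed.
    hall : ∀ k → HallBelow k
    hall (suc k) X Y ∣X∣<1+k X∩Y=∅ hallXY with ∣ X ∣ ≤? 0
    ... | yes ∣X∣≤0 = [] , ([] , []) , sym (n≤0⇒n≡0 ∣X∣≤0)
    ... | no  ∣X∣≰0 with 0<∣p∣⇒Nonempty X (≰⇒> ∣X∣≰0) | critical? X Y
    ...   | _ , _   | yes (_ , Z-critical) =
            hall-critical (hall k) (≤-pred ∣X∣<1+k) X∩Y=∅ hallXY Z-critical
    ...   | _ , x∈X | no no-critical =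
            hall-surplus (hall k) (≤-pred ∣X∣<1+k) X∩Y=∅ hallXY no-critical x∈X

  module _ {n} (G : Graph n) where

    maximumIndependent-size : ∀ {α A} → IsIndependenceNumber G α → IsMaximumIndependent G A →
      ∣ A ∣ ≡ α
    maximumIndependent-size (S , (S-ind , S-max) , ∣S∣≡α) (A-ind , A-max) =
      trans (≤-antisym (S-max _ A-ind) (A-max S S-ind)) ∣S∣≡α

    symmetricDifference-∉-closedNbhd : ∀ {A B} → IsIndependent G A → IsIndependent G B →
      ¬ (((_∈ A ─ B) ∪ₚ (_∈ B ─ A)) ≬ ClosedNbhd G (A ∩ B))
    symmetricDifference-∉-closedNbhd {A} {B} A-ind B-ind (v , v∈A─B⊎v∈B─A , v∈N[A∩B])
      with v∈A─B⊎v∈B─A | v∈N[A∩B]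
    ... | inj₁ v∈A─B | inj₁ v∈A∩B             = x∈p─q⇒x∉q v∈A─B (p∩q⊆q A B v∈A∩B)
    ... | inj₂ v∈B─A | inj₁ v∈A∩B             = x∈p─q⇒x∉q v∈B─A (p∩q⊆p A B v∈A∩B)
    ... | inj₁ v∈A─B | inj₂ (u , u∈A∩B , uv)  = A-ind u v (p∩q⊆p A B u∈A∩B) (p─q⊆p A B v∈A─B) uv
    ... | inj₂ v∈B─A | inj₂ (u , u∈A∩B , uv)  = B-ind u v (p∩q⊆q A B u∈A∩B) (p─q⊆p B A v∈B─A) uv

  module _ {n} (G : Graph n) (adj? : ∀ u v → Dec (Adj G u v)) where
    open Hall G adj?

    independent-exchange : ∀ {A B Z} → IsIndependent G A → IsIndependent G B → Z ⊆ A →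
      IsIndependent G ((B ─ N Z) ∪ Z)
    independent-exchange {B = B} {Z} A-ind B-ind Z⊆A u v u∈ v∈ uv
      with x∈p∪q⁻ (B ─ N Z) Z u∈ | x∈p∪q⁻ (B ─ N Z) Z v∈
    ... | inj₁ u∈B─NZ | inj₁ v∈B─NZ =
            B-ind u v (p─q⊆p B (N Z) u∈B─NZ) (p─q⊆p B (N Z) v∈B─NZ) uv
    ... | inj₁ u∈B─NZ | inj₂ v∈Z    = x∈p─q⇒x∉q u∈B─NZ (N⁺ v∈Z (Graph.sym G uv))
    ... | inj₂ u∈Z    | inj₁ v∈B─NZ = x∈p─q⇒x∉q v∈B─NZ (N⁺ u∈Z uv)
    ... | inj₂ u∈Z    | inj₂ v∈Z    = A-ind u v (Z⊆A u∈Z) (Z⊆A v∈Z) uv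

    maximumIndependent-hallCondition : ∀ {A B} →
      IsMaximumIndependent G A → IsMaximumIndependent G B → HallCondition (A ─ B) (B ─ A)
    maximumIndependent-hallCondition {A} {B} (A-ind , _) (B-ind , B-max) Z Z⊆A─B = begin
      ∣ Z ∣              ≤⟨ +-cancelˡ-≤ ∣ B ─ N Z ∣ _ _ exchange-bound ⟩
      ∣ B ∩ N Z ∣        ≤⟨ p⊆q⇒∣p∣≤∣q∣ B∩NZ⊆NZ∩B─A ⟩
      ∣ N Z ∩ (B ─ A) ∣  ∎
      where
      open ≤-Reasoning
      Z⊆A : Z ⊆ A
      Z⊆A = ⊆-trans Z⊆A─B (p─q⊆p A B)
      B─NZ∩Z-empty : Empty ((B ─ N Z) ∩ Z)
      B─NZ∩Z-empty (_ , v∈) with x∈p∩q⁻ (B ─ N Z) Z v∈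
      ... | v∈B─NZ , v∈Z = x∈p─q⇒x∉q (Z⊆A─B v∈Z) (p─q⊆p B (N Z) v∈B─NZ)
      exchange-bound : ∣ B ─ N Z ∣ + ∣ Z ∣ ≤ ∣ B ─ N Z ∣ + ∣ B ∩ N Z ∣
      exchange-bound = begin
        ∣ B ─ N Z ∣ + ∣ Z ∣        ≡⟨ ∣p∪q∣≡∣p∣+∣q∣ B─NZ∩Z-empty ⟨
        ∣ (B ─ N Z) ∪ Z ∣          ≤⟨ B-max _ (independent-exchange A-ind B-ind Z⊆A) ⟩
        ∣ B ∣                      ≡⟨ ∣p∣≡∣p∩q∣+∣p─q∣ B (N Z) ⟩
        ∣ B ∩ N Z ∣ + ∣ B ─ N Z ∣  ≡⟨ +-comm ∣ B ∩ N Z ∣ ∣ B ─ N Z ∣ ⟩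
        ∣ B ─ N Z ∣ + ∣ B ∩ N Z ∣  ∎
      B∩NZ⊆NZ∩B─A : B ∩ N Z ⊆ N Z ∩ (B ─ A)
      B∩NZ⊆NZ∩B─A {v} v∈ with x∈p∩q⁻ B (N Z) v∈
      ... | v∈B , v∈NZ with N⁻ v∈NZ
      ...   | u , u∈Z , uv =
              x∈p∩q⁺ (v∈NZ , x∈p∧x∉q⇒x∈p─q v∈B (λ v∈A → A-ind u v (Z⊆A u∈Z) v∈A uv))

    ∣A─B∣+ν≤μ : ∀ {A B μ ν} → IsMaximumIndependent G A → IsMaximumIndependent G B →
      IsMatchingNumberIn G Everything μ → IsMatchingNumberIn G (ClosedNbhd G (A ∩ B)) ν →
      ∣ A ─ B ∣ + ν ≤ μ
    ∣A─B∣+ν≤μ {A} {B} A-max@(A-ind , _) B-max@(B-ind , _) μ-number (ν-matching , _) =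
      hasMatching⇒≤matchingNumber G μ-number (hasMatching-mono G (λ _ → tt)
        (hasMatching-++ G (symmetricDifference-∉-closedNbhd G A-ind B-ind) A─B-matching ν-matching))
      where
      A─B∩B─A=∅ : ¬ ((_∈ A ─ B) ≬ (_∈ B ─ A))
      A─B∩B─A=∅ (_ , v∈A─B , v∈B─A) = x∈p─q⇒x∉q v∈A─B (p─q⊆p B A v∈B─A)
      A─B-matching : HasMatchingOfSize G ((_∈ A ─ B) ∪ₚ (_∈ B ─ A)) ∣ A ─ B ∣
      A─B-matching = hall (suc ∣ A ─ B ∣) (A ─ B) (B ─ A) ≤-refl A─B∩B─A=∅
        (maximumIndependent-hallCondition A-max B-max)

    independence-matching-bound : ∀ {α μ ν A B} → IsIndependenceNumber G α →
      IsMatchingNumberIn G Everything μ → IsMaximumIndependent G A → IsMaximumIndependent G B →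
      IsMatchingNumberIn G (ClosedNbhd G (A ∩ B)) ν → α + ν ≤ μ + ∣ A ∩ B ∣
    independence-matching-bound {α} {μ} {ν} {A} {B} α-number μ-number A-max B-max ν-number = begin
      α + ν                          ≡⟨ cong (_+ ν) (maximumIndependent-size G α-number A-max) ⟨
      ∣ A ∣ + ν                      ≡⟨ cong (_+ ν) (∣p∣≡∣p∩q∣+∣p─q∣ A B) ⟩
      ∣ A ∩ B ∣ + ∣ A ─ B ∣ + ν      ≡⟨ +-assoc ∣ A ∩ B ∣ ∣ A ─ B ∣ ν ⟩
      ∣ A ∩ B ∣ + (∣ A ─ B ∣ + ν)    ≤⟨ +-monoʳ-≤ ∣ A ∩ B ∣ ∣A─B∣+ν≤μ′ ⟩
      ∣ A ∩ B ∣ + μ                  ≡⟨ +-comm ∣ A ∩ B ∣ μ ⟩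
      μ + ∣ A ∩ B ∣                  ∎
      where
      open ≤-Reasoning
      ∣A─B∣+ν≤μ′ : ∣ A ─ B ∣ + ν ≤ μ
      ∣A─B∣+ν≤μ′ = ∣A─B∣+ν≤μ A-max B-max μ-number ν-number

  -- Adjacency is an arbitrary relation, decidable only under double negation; this suffices
  -- because the conclusion is a decidable inequality.
  α+ν≤μ+∣A∩B∣ : ∀ {n} (G : Graph n) {α μ ν A B} → IsIndependenceNumber G α →
    IsMatchingNumberIn G Everything μ → IsMaximumIndependent G A → IsMaximumIndependent G B →
    IsMatchingNumberIn G (ClosedNbhd G (A ∩ B)) ν → α + ν ≤ μ + ∣ A ∩ B ∣
  α+ν≤μ+∣A∩B∣ G {α} {μ} {ν} {A} {B} α-number μ-number A-max B-max ν-number =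
    decidable-stable (α + ν ≤? μ + ∣ A ∩ B ∣)
      (¬¬-map (λ adj? → independence-matching-bound G adj? α-number μ-number A-max B-max ν-number)
        (¬¬-decidable (Adj G)))

open MatchingBound using (α+ν≤μ+∣A∩B∣)
open import Data.Nat as ℕ using (ℕ)
open import Data.Nat.Properties using (m+n∸n≡m; m≤n+m)
open import Data.Integer using (+_; _+_; _-_; _≤_; _⊖_)
import Data.Integer.Properties as ℤ
open import Data.Fin.Subset using (Subset; _∩_; ∣_∣)
open import Data.Product using (_×_; ∃-syntax)
open import Relation.Nullary using (¬_)
open import Relation.Binary.PropositionalEquality using (_≡_; cong)

m+o≤n+p⇒+m≤+n+[+p-+o] : ∀ {m n o p} → m ℕ.+ o ℕ.≤ n ℕ.+ p → + m ≤ + n + (+ p - + o)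
m+o≤n+p⇒+m≤+n+[+p-+o] {m} {n} {o} {p} m+o≤n+p = begin
  + m                  ≡⟨ cong +_ (m+n∸n≡m m o) ⟨
  + (m ℕ.+ o ℕ.∸ o)    ≡⟨ ℤ.⊖-≥ (m≤n+m o m) ⟨
  (m ℕ.+ o) ⊖ o        ≤⟨ ℤ.⊖-monoˡ-≤ o m+o≤n+p ⟩
  (n ℕ.+ p) ⊖ o        ≡⟨ ℤ.distribʳ-⊖-+-pos n p o ⟨
  + n + (p ⊖ o)        ≡⟨ cong (_+_ (+ n)) (ℤ.[+m]-[+n]≡m⊖n p o) ⟨
  + n + (+ p - + o)    ∎
  where open ℤ.≤-Reasoning

corollary5 : ∀ {n} (G : Graph n)
    → (∃[ A₀ ] ∃[ B₀ ] (IsMaximumIndependent G A₀ × IsMaximumIndependent G B₀ × ¬ A₀ ≡ B₀))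
    → ∀ (α μ : ℕ) → IsIndependenceNumber G α → IsMatchingNumberIn G Everything μ
    → ∀ (A B : Subset n) → IsMaximumIndependent G A → IsMaximumIndependent G B
    → ∀ (ν : ℕ) → IsMatchingNumberIn G (ClosedNbhd G (A ∩ B)) ν
    → + α ≤ + μ + (+ ∣ A ∩ B ∣ - + ν)
corollary5 G _ α μ α-number μ-number A B A-max B-max ν ν-number =
  m+o≤n+p⇒+m≤+n+[+p-+o] (α+ν≤μ+∣A∩B∣ G α-number μ-number A-max B-max ν-number)
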